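{- Let $G$ be a graph, $t\in\mathbb{N}$, $X$ a tidy modulator of $G$, and $C$ a connected component of $G - X$ such that (1) $N_G(C)$ is a limit-2 clique for $(G - V(C), t)$, and (2) for every two-element set $\{x,y\} \subseteq N_G(C)$, either $\mathrm{tw}(G[V(C)\cup\{x,y\}]) \le 2$ or $\{x,y\}$ is a limit-1 subset for $(G - V(C), t)$. Then $\mathrm{TW2D}(G) \le t$ if and only if $\mathrm{TW2D}(G - V(C)) \le t$.
   Context: Graphs are finite, simple, undirected; $\mathrm{tw}$ is treewidth; $\mathrm{TW2D}(G)$ is the minimum size of $S\subseteq V(G)$ with $\mathrm{tw}(G-S)\le 2$. A modulator of $G$ is $X\subseteq V(G)$ with $\mathrm{tw}(G-X)\le 2$; it is tidy if $\mathrm{tw}(G-(X\setminus\{x\}))\le 2$ for every $x\in X$. A solution for $(H,t)$ is $S\subseteq V(H)$ with $|S|\le t$ and $\mathrm{tw}(H-S)\le 2$. $Z\subseteq V(H)$ is a limit-$m$ subset for $(H,t)$ if every solution $S$ for $(H,t)$ has $|Z\setminus S|\le m$, and a limit-$m$ clique if additionally $H[Z]$ is a clique. $N_G(C)$ is the set of vertices outside $V(C)$ adjacent to $C$. -}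

module Defs where

open import Data.Nat using (ℕ; zero; suc; _≤_)
open import Data.Fin using (Fin; zero; suc; toℕ)
open import Data.Fin.Subset using (Subset; _∈_; _∉_; _⊆_; ∁; _∪_; _─_; ⁅_⁆; ∣_∣; ⊤; Nonempty)
open import Data.Bool using (Bool; true; false; T; not; _∧_; _∨_)
open import Data.Vec using (tabulate; lookup)
open import Data.Product using (Σ; ∃; _×_; _,_)
open import Data.Sum using (_⊎_)
open import Relation.Binary.PropositionalEquality using (_≡_; _≢_)

record Graph (n : ℕ) : Set where
  field
    adj   : Fin n → Fin n → Bool
    sym   : ∀ u v → adj u v ≡ adj v u
    irrefl : ∀ v → adj v v ≡ false

open Graph public

Adj : ∀ {n} → Graph n → Fin n → Fin n → Set
Adj G u v = T (adj G u v)

-- Walks inside a vertex set: Reach R P a b  means there is a walk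
-- a = c₀ R c₁ R … R cₖ = b with every cᵢ satisfying P.

data Reach {A : Set} (R : A → A → Set) (P : A → Set) : A → A → Set where
  here : ∀ {a} → P a → Reach R P a a
  step : ∀ {a b c} → P a → R a b → Reach R P b c → Reach R P a c

-- Trees.  A tree on the nodes Fin (suc m) is given by a parent map:
-- node (suc i) has a parent of smaller index (node zero is the root).
-- Every finite nonempty tree arises this way.

record Tree : Set where
  field
    size-1  : ℕ
    parent  : Fin size-1 → Fin (suc size-1)
    parent< : ∀ i → toℕ (parent i) ≤ toℕ i

  Node : Set
  Node = Fin (suc size-1)

  TAdj : Node → Node → Set
  TAdj a b = ∃ λ i → (a ≡ suc i × b ≡ parent i) ⊎ (b ≡ suc i × a ≡ parent i)

open Tree public

record TreeDecomposition {n : ℕ} (G : Graph n) (U : Subset n) (k : ℕ) : Set where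
  field
    tree   : Tree
    bag    : Node tree → Subset n
    bag⊆U  : ∀ a → bag a ⊆ U
    cover  : ∀ v → v ∈ U → ∃ λ a → v ∈ bag a
    edges  : ∀ u v → u ∈ U → v ∈ U → Adj G u v → ∃ λ a → u ∈ bag a × v ∈ bag a
    connected : ∀ v a b → v ∈ bag a → v ∈ bag b →
                Reach (TAdj tree) (λ c → v ∈ bag c) a b
    width  : ∀ a → ∣ bag a ∣ ≤ suc k

TwLe : ∀ {n} → Graph n → Subset n → ℕ → Set
TwLe G U k = TreeDecomposition G U k

-- Notions from the paper.  Subgraphs G - S are represented as induced
-- subgraphs G[U] with U = ∁ S (vertex set kept as a subset of Fin n).

Modulator : ∀ {n} → Graph n → Subset n → Set
Modulator G X = TwLe G (∁ X) 2

TidyModulator : ∀ {n} → Graph n → Subset n → Set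
TidyModulator G X = Modulator G X × (∀ x → x ∈ X → TwLe G (∁ (X ─ ⁅ x ⁆)) 2)

Solution : ∀ {n} → Graph n → Subset n → ℕ → Subset n → Set
Solution G U t S = S ⊆ U × ∣ S ∣ ≤ t × TwLe G (U ─ S) 2

LimitSubset : ∀ {n} → Graph n → Subset n → ℕ → ℕ → Subset n → Set
LimitSubset G U t m Z = Z ⊆ U × (∀ S → Solution G U t S → ∣ Z ─ S ∣ ≤ m)

LimitClique : ∀ {n} → Graph n → Subset n → ℕ → ℕ → Subset n → Set
LimitClique G U t m Z =
  LimitSubset G U t m Z × (∀ u v → u ∈ Z → v ∈ Z → u ≢ v → Adj G u v)

TW2DLe : ∀ {n} → Graph n → Subset n → ℕ → Set
TW2DLe G U t = ∃ λ S → Solution G U t S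

Component : ∀ {n} → Graph n → Subset n → Subset n → Set
Component G W C =
  C ⊆ W × Nonempty C
  × (∀ u v → u ∈ C → v ∈ C → Reach (Adj G) (_∈ C) u v)
  × (∀ u v → u ∈ C → v ∈ W → Adj G u v → v ∈ C)

anyFin : ∀ {n} → (Fin n → Bool) → Bool
anyFin {zero}  f = false
anyFin {suc n} f = f zero ∨ anyFin (λ i → f (suc i))

Nbh : ∀ {n} → Graph n → Subset n → Subset n
Nbh G C = tabulate λ v → not (lookup C v) ∧ anyFin (λ u → lookup C u ∧ adj G u v)

-- Only the backward direction needs work.  Let S be a solution for G − C and K = N(C) ∖ S.
-- Since N(C) is a limit-2 clique, K is a clique with at most two vertices, so some bag of a
-- width-2 decomposition of G − C − S contains K.  On the side of C we find a width-2
-- decomposition of a vertex set containing C ∪ K, again with a bag containing K: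
-- G − X if K = ∅; G − (X ∖ {x}), by tidiness, if K = {x} (note N(C) ⊆ X as C is a component
-- of G − X); and G[C ∪ {x, y}] if K = {x, y}, by hypothesis (2), whose other alternative is
-- impossible because x, y ∉ S.  As K separates C from the rest of G − S, rerooting the
-- second decomposition at its bag containing K and hanging it below the first one's gives a
-- width-2 decomposition of G − S.

module Submission where

open import Defs hiding (sym)
open import Data.Bool using (Bool; true; false; T; not; _∧_)
open import Data.Bool.Properties using (T-≡; T-∧; T-∨)
open import Data.Fin using (Fin; zero; suc; toℕ; _≟_; punchIn; punchOut; _↑ˡ_; _↑ʳ_; splitAt)
import Data.Fin as Fin
open import Data.Fin.Induction using (<-wellFounded)
open import Data.Fin.Properties
  using (punchInᵢ≢i; punchOut-cong; punchIn-punchOut; punchOut-punchIn; punchOut-cancel-≤;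
         toℕ-↑ˡ; toℕ-↑ʳ; splitAt-↑ˡ; splitAt-↑ʳ; splitAt⁻¹-↑ˡ; splitAt⁻¹-↑ʳ; toℕ≤pred[n])
open import Data.Fin.Subset
  using (Subset; _∈_; _∉_; _⊆_; ∁; _∪_; _∩_; _─_; _-_; ⁅_⁆; ∣_∣; ⊤; Empty; inside; outside)
open import Data.Fin.Subset.Properties
  using (_∈?_; nonempty?; x∈⁅x⁆; x∈⁅y⁆⇒x≡y; x∉⁅y⁆⇒x≢y; x∈p∪q⁺; x∈p∪q⁻;
         x∈p∩q⁺; x∈p∩q⁻; p∩q⊆q; ∣p∩q∣≤∣p∣; p─q⊆p; x∈p∧x∉q⇒x∈p─q; x∈p∧x≢y⇒x∈p-y;
         x∈p⇒∣p-x∣<∣p∣; x∈∁p⇒x∉p; x∉p⇒x∈∁p; ∈⊤; ⊆⊤; p⊆q⇒∁p⊇∁q)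
open import Data.Nat using (ℕ; zero; suc; _+_; _≤_; _<_; z≤n; s≤s)
open import Data.Nat.Properties
  using (≤-trans; m≤m+n; +-suc; +-monoʳ-≤; <⇒≱; ≰⇒>; module ≤-Reasoning)
open import Data.Product using (Σ; ∃; _×_; _,_; proj₁; proj₂)
open import Data.Sum using (_⊎_; inj₁; inj₂; [_,_]′)
open import Data.Vec using (_∷_; here; there; lookup)
open import Data.Vec.Properties using (lookup∘tabulate; []=⇒lookup; lookup⇒[]=)
open import Function using (_∘_; id)
open import Function.Bundles using (_⇔_; mk⇔; Equivalence)
open import Induction.WellFounded using (Acc; acc)
open import Relation.Binary.PropositionalEquality
  using (_≡_; _≢_; refl; sym; trans; cong; subst; subst₂)
open import Relation.Nullary using (¬_; yes; no; contradiction)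

open Equivalence using (to; from)
open TreeDecomposition

private
  variable
    n k : ℕ

x∈p─q⇒x∉q : ∀ (p q : Subset n) {x} → x ∈ p ─ q → x ∉ q
x∈p─q⇒x∉q (inside ∷ p) (outside ∷ q) here ()
x∈p─q⇒x∉q (_ ∷ p) (_ ∷ q) (there x∈p─q) (there x∈q) = x∈p─q⇒x∉q p q x∈p─q x∈q

x∈p⇒⁅x⁆⊆p : ∀ {p : Subset n} {x} → x ∈ p → ⁅ x ⁆ ⊆ p
x∈p⇒⁅x⁆⊆p {p = p} x∈p v∈⁅x⁆ = subst (_∈ p) (sym (x∈⁅y⁆⇒x≡y _ v∈⁅x⁆)) x∈p

p⊆q⇒p─r⊆q─r : ∀ {p q : Subset n} (r : Subset n) → p ⊆ q → p ─ r ⊆ q ─ r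
p⊆q⇒p─r⊆q─r r p⊆q v∈p─r = x∈p∧x∉q⇒x∈p─q (p⊆q (p─q⊆p _ r v∈p─r)) (x∈p─q⇒x∉q _ r v∈p─r)

x∈p∧y∈p∧x≢y⇒2≤∣p∣ : ∀ {p : Subset n} {x y} → x ∈ p → y ∈ p → x ≢ y → 2 ≤ ∣ p ∣
x∈p∧y∈p∧x≢y⇒2≤∣p∣ {p = p} {x} x∈p y∈p x≢y =
  ≤-trans (s≤s (≤-trans (s≤s z≤n) (x∈p⇒∣p-x∣<∣p∣ y∈p-x))) (x∈p⇒∣p-x∣<∣p∣ x∈p)
  where y∈p-x = x∈p∧x≢y⇒x∈p-y y∈p (x≢y ∘ sym)

data AtMostTwo (p : Subset n) : Set where
  none : Empty p → AtMostTwo p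
  one  : ∀ {x} → x ∈ p → p ⊆ ⁅ x ⁆ → AtMostTwo p
  two  : ∀ {x y} → x ∈ p → y ∈ p → x ≢ y → p ⊆ ⁅ x ⁆ ∪ ⁅ y ⁆ → AtMostTwo p

∣p∣≤2⇒AtMostTwo : ∀ (p : Subset n) → ∣ p ∣ ≤ 2 → AtMostTwo p
∣p∣≤2⇒AtMostTwo p ∣p∣≤2 with nonempty? p
... | no p≡∅ = none p≡∅
... | yes (x , x∈p) with nonempty? (p - x)
...   | no p-x≡∅ = one x∈p p⊆x
  where
  p⊆x : p ⊆ ⁅ x ⁆
  p⊆x {v} v∈p with v ≟ x
  ... | yes refl = x∈⁅x⁆ x
  ... | no v≢x = contradiction (v , x∈p∧x≢y⇒x∈p-y v∈p v≢x) p-x≡∅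
...   | yes (y , y∈p-x) with nonempty? (p - x - y)
...     | no p-x-y≡∅ = two x∈p (p─q⊆p p ⁅ x ⁆ y∈p-x) x≢y p⊆x,y
  where
  x≢y : x ≢ y
  x≢y x≡y = x∉⁅y⁆⇒x≢y (x∈p─q⇒x∉q p ⁅ x ⁆ y∈p-x) (sym x≡y)
  p⊆x,y : p ⊆ ⁅ x ⁆ ∪ ⁅ y ⁆
  p⊆x,y {v} v∈p with v ≟ x | v ≟ y
  ... | yes refl | _        = x∈p∪q⁺ (inj₁ (x∈⁅x⁆ x))
  ... | no _     | yes refl = x∈p∪q⁺ (inj₂ (x∈⁅x⁆ y))
  ... | no v≢x   | no v≢y   =
    contradiction (v , x∈p∧x≢y⇒x∈p-y (x∈p∧x≢y⇒x∈p-y v∈p v≢x) v≢y) p-x-y≡∅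
...     | yes (z , z∈p-x-y) = contradiction ∣p∣≤2 (<⇒≱ 2<∣p∣)
  where
  open ≤-Reasoning
  2<∣p∣ : 2 < ∣ p ∣
  2<∣p∣ = begin
    3                     ≤⟨ m≤m+n 3 _ ⟩
    3 + ∣ p - x - y - z ∣ ≤⟨ +-monoʳ-≤ 2 (x∈p⇒∣p-x∣<∣p∣ z∈p-x-y) ⟩
    2 + ∣ p - x - y ∣     ≤⟨ +-monoʳ-≤ 1 (x∈p⇒∣p-x∣<∣p∣ y∈p-x) ⟩
    1 + ∣ p - x ∣         ≤⟨ x∈p⇒∣p-x∣<∣p∣ x∈p ⟩
    ∣ p ∣                 ∎

x∈p⇔T[p[x]] : ∀ {p : Subset n} {x} → x ∈ p ⇔ T (lookup p x)
x∈p⇔T[p[x]] {p = p} {x} =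
  mk⇔ (from T-≡ ∘ []=⇒lookup) (lookup⇒[]= x p ∘ to T-≡)

T-not : ∀ {b} → T (not b) ⇔ (¬ T b)
T-not {true}  = mk⇔ (λ ()) (λ ¬t → ¬t _)
T-not {false} = mk⇔ (λ _ ()) _

T-anyFin : ∀ (f : Fin n → Bool) → T (anyFin f) ⇔ ∃ λ u → T (f u)
T-anyFin {zero}  f = mk⇔ (λ ()) (λ ())
T-anyFin {suc n} f = mk⇔ ⇒ ⇐
  where
  ⇒ : T (anyFin f) → ∃ λ u → T (f u)
  ⇒ t with to T-∨ t
  ... | inj₁ t₀ = zero , t₀
  ... | inj₂ t₊ = let u , tu = to (T-anyFin (f ∘ suc)) t₊ in suc u , tu
  ⇐ : (∃ λ u → T (f u)) → T (anyFin f)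
  ⇐ (zero  , t) = from T-∨ (inj₁ t)
  ⇐ (suc u , t) = from T-∨ (inj₂ (from (T-anyFin (f ∘ suc)) (u , t)))

x∈Nbh⇔ : ∀ (G : Graph n) (C : Subset n) {v} →
  v ∈ Nbh G C ⇔ (v ∉ C × ∃ λ u → u ∈ C × Adj G u v)
x∈Nbh⇔ G C {v} = mk⇔ ⇒ ⇐
  where
  Nbh[v]≡ = lookup∘tabulate (λ w → not (lookup C w) ∧ anyFin (λ u → lookup C u ∧ adj G u w)) v
  ⇒ : v ∈ Nbh G C → v ∉ C × ∃ λ u → u ∈ C × Adj G u v
  ⇒ v∈N =
    let v∉C , ∃u = to T-∧ (subst T Nbh[v]≡ (to x∈p⇔T[p[x]] v∈N))
        u , u∈C∧uv = to (T-anyFin _) ∃u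
        u∈C , uv = to T-∧ u∈C∧uv
    in to T-not v∉C ∘ to x∈p⇔T[p[x]] , u , from x∈p⇔T[p[x]] u∈C , uv
  ⇐ : v ∉ C × ∃ (λ u → u ∈ C × Adj G u v) → v ∈ Nbh G C
  ⇐ (v∉C , u , u∈C , uv) =
    from x∈p⇔T[p[x]] (subst T (sym Nbh[v]≡) (from T-∧
      ( from T-not (v∉C ∘ from x∈p⇔T[p[x]])
      , from (T-anyFin _) (u , from T-∧ (to x∈p⇔T[p[x]] u∈C , uv)))))

Adj-sym : ∀ (G : Graph n) {u v} → Adj G u v → Adj G v u
Adj-sym G {u} {v} = subst T (Graph.sym G u v)

Nbh⊆∁ : ∀ (G : Graph n) (C : Subset n) → Nbh G C ⊆ ∁ C
Nbh⊆∁ G C v∈N = x∉p⇒x∈∁p (proj₁ (to (x∈Nbh⇔ G C) v∈N))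

Nbh-component⊆ : ∀ (G : Graph n) {X C : Subset n} → Component G (∁ X) C → Nbh G C ⊆ X
Nbh-component⊆ G {X} {C} (_ , _ , _ , closed) {v} v∈N with v ∈? X
... | yes v∈X = v∈X
... | no v∉X =
  let v∉C , u , u∈C , uv = to (x∈Nbh⇔ G C) v∈N
  in contradiction (closed u v u∈C (x∉p⇒x∈∁p v∉X) uv) v∉C

module _ {A : Set} {R : A → A → Set} {P : A → Set} where

  Reach-start : ∀ {a b} → Reach R P a b → P a
  Reach-start (here p)     = p
  Reach-start (step p _ _) = p

  Reach-++ : ∀ {a b c} → Reach R P a b → Reach R P b c → Reach R P a c
  Reach-++ (here _)     w′ = w′
  Reach-++ (step p r w) w′ = step p r (Reach-++ w w′)

  Reach-reverse : (∀ {a b} → R a b → R b a) → ∀ {a b} → Reach R P a b → Reach R P b a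
  Reach-reverse R-sym (here p)     = here p
  Reach-reverse R-sym (step p r w) =
    Reach-++ (Reach-reverse R-sym w) (step (Reach-start w) (R-sym r) (here p))

Reach-map : ∀ {A B : Set} {R : A → A → Set} {P : A → Set} {R′ : B → B → Set} {P′ : B → Set}
  (f : A → B) → (∀ {a b} → R a b → R′ (f a) (f b)) → (∀ {a} → P a → P′ (f a)) →
  ∀ {a b} → Reach R P a b → Reach R′ P′ (f a) (f b)
Reach-map f f-R f-P (here p)     = here (f-P p)
Reach-map f f-R f-P (step p r w) = step (f-P p) (f-R r) (Reach-map f f-R f-P w)

TAdj-sym : ∀ (T : Tree) {a b} → TAdj T a b → TAdj T b a
TAdj-sym T (i , inj₁ edge) = i , inj₂ edge
TAdj-sym T (i , inj₂ edge) = i , inj₁ edge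

TAdj-root⇒child : ∀ (T : Tree) {a} → TAdj T a zero → ∃ λ i → a ≡ suc i × parent T i ≡ zero
TAdj-root⇒child T (i , inj₁ (a≡suc-i , zero≡parent)) = i , a≡suc-i , sym zero≡parent

-- Rerooting tree decompositions

module Rotation (T : Tree) (i : Fin (size-1 T)) (parent-i≡root : parent T i ≡ zero) where

  c : Node T
  c = suc i

  -- the parent of a node once the tree is rooted at c
  toward-c : Node T → Node T
  toward-c zero    = c
  toward-c (suc j) = parent T j

  toward-c< : ∀ w → c ≢ toward-c w → toℕ (toward-c w) < toℕ w
  toward-c< zero    c≢c = contradiction refl c≢c
  toward-c< (suc j) _   = s≤s (parent< T j)

  -- moves c to the front, keeping the order of the other nodes so that parents still precede children
  front : Node T → Node T
  front w with c ≟ w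
  ... | yes _   = zero
  ... | no c≢w = suc (punchOut c≢w)

  back : Node T → Node T
  back zero    = c
  back (suc j) = punchIn c j

  front-c : ∀ {w} → c ≡ w → front w ≡ zero
  front-c {w} c≡w with c ≟ w
  ... | yes _   = refl
  ... | no c≢w = contradiction c≡w c≢w

  front-≢ : ∀ {w} (c≢w : c ≢ w) → front w ≡ suc (punchOut c≢w)
  front-≢ {w} c≢w with c ≟ w
  ... | yes c≡w = contradiction c≡w c≢w
  ... | no _    = cong suc (punchOut-cong c refl)

  front-back : ∀ w → front (back w) ≡ w
  front-back zero    = front-c refl
  front-back (suc j) = trans (front-≢ (punchInᵢ≢i c j ∘ sym)) (cong suc (punchOut-punchIn c))

  back-front : ∀ w → back (front w) ≡ w
  back-front w with c ≟ w
  ... | yes c≡w = c≡w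
  ... | no c≢w  = punchIn-punchOut c≢w

  rotated-parent : Fin (size-1 T) → Node T
  rotated-parent j = front (toward-c (punchIn c j))

  rotated-parent< : ∀ j → toℕ (rotated-parent j) ≤ toℕ j
  rotated-parent< j with c ≟ toward-c (punchIn c j)
  ... | yes _ = z≤n
  ... | no c≢toward = subst (λ j′ → toℕ (punchOut c≢toward) < toℕ j′) (punchOut-punchIn c)
                    (≰⇒> λ le → <⇒≱ (toward-c< w c≢toward) (punchOut-cancel-≤ c≢w c≢toward le))
    where
    w = punchIn c j
    c≢w : c ≢ w
    c≢w = punchInᵢ≢i c j ∘ sym

  rotated : Tree
  rotated = record { size-1 = size-1 T ; parent = rotated-parent ; parent< = rotated-parent< }

  front-edge : ∀ j → TAdj rotated (front (suc j)) (front (parent T j))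
  front-edge j with c ≟ suc j
  ... | yes refl = punchOut c≢root , inj₂ (front-parent-i , sym rotated-parent≡root)
    where
    c≢root : c ≢ zero
    c≢root ()
    front-parent-i : front (parent T i) ≡ suc (punchOut c≢root)
    front-parent-i = trans (cong front parent-i≡root) (front-≢ c≢root)
    rotated-parent≡root : rotated-parent (punchOut c≢root) ≡ zero
    rotated-parent≡root = trans (cong (front ∘ toward-c) (punchIn-punchOut c≢root)) (front-c refl)
  ... | no c≢suc-j = punchOut c≢suc-j ,
    inj₁ (refl , sym (cong (front ∘ toward-c) (punchIn-punchOut c≢suc-j)))

  front-adj : ∀ {a b} → TAdj T a b → TAdj rotated (front a) (front b)
  front-adj (j , inj₁ (refl , refl)) = front-edge j
  front-adj (j , inj₂ (refl , refl)) = TAdj-sym rotated (front-edge j)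

module _ {G : Graph n} {U : Subset n} {k : ℕ} where

  record Relabelling (D D′ : TreeDecomposition G U k) : Set where
    field
      node     : Node (tree D) → Node (tree D′)
      bag-node : ∀ a → bag D′ (node a) ≡ bag D a
      adj-node : ∀ {a b} → TAdj (tree D) a b → TAdj (tree D′) (node a) (node b)

  open Relabelling

  Relabelling-trans : ∀ {D₁ D₂ D₃} → Relabelling D₁ D₂ → Relabelling D₂ D₃ → Relabelling D₁ D₃
  Relabelling-trans r₁₂ r₂₃ = record
    { node     = node r₂₃ ∘ node r₁₂
    ; bag-node = λ a → trans (bag-node r₂₃ (node r₁₂ a)) (bag-node r₁₂ a)
    ; adj-node = adj-node r₂₃ ∘ adj-node r₁₂
    }

  RerootedAt : (D : TreeDecomposition G U k) → Node (tree D) → Set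
  RerootedAt D a = Σ (TreeDecomposition G U k) λ D′ → Σ (Relabelling D D′) λ r → node r a ≡ zero

  rotate : (D : TreeDecomposition G U k) (i : Fin (size-1 (tree D))) →
    parent (tree D) i ≡ zero → RerootedAt D (suc i)
  rotate D i parent-i≡root = D′ , relabelling , front-c refl
    where
    open Rotation (tree D) i parent-i≡root
    bag-back-front : ∀ a → bag D (back (front a)) ≡ bag D a
    bag-back-front a = cong (bag D) (back-front a)
    D′ : TreeDecomposition G U k
    D′ = record
      { tree      = rotated
      ; bag       = bag D ∘ back
      ; bag⊆U     = bag⊆U D ∘ back
      ; cover     = λ v v∈U → let a , v∈a = cover D v v∈U in
                      front a , subst (v ∈_) (sym (bag-back-front a)) v∈a
      ; edges     = λ u v u∈U v∈U uv → let a , u∈a , v∈a = edges D u v u∈U v∈U uv in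
                      front a , subst (u ∈_) (sym (bag-back-front a)) u∈a
                              , subst (v ∈_) (sym (bag-back-front a)) v∈a
      ; connected = λ v a b v∈a v∈b →
                      subst₂ (Reach (TAdj rotated) (λ c → v ∈ bag D (back c))) (front-back a) (front-back b)
                        (Reach-map front front-adj (λ {c} → subst (v ∈_) (sym (bag-back-front c)))
                          (connected D v (back a) (back b) v∈a v∈b))
      ; width     = width D ∘ back
      }
    relabelling : Relabelling D D′
    relabelling = record { node = front ; bag-node = bag-back-front ; adj-node = front-adj }

  reroot-at : (D : TreeDecomposition G U k) (a : Node (tree D)) → Acc Fin._<_ a → RerootedAt D a
  reroot-at D zero    _        = D , record { node = id ; bag-node = λ _ → refl ; adj-node = id } , refl
  reroot-at D (suc i) (acc rs) with reroot-at D (parent (tree D) i) (rs (s≤s (parent< (tree D) i)))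
  ... | D₁ , r₁ , r₁-parent≡root
    with TAdj-root⇒child (tree D₁) (subst (TAdj (tree D₁) (node r₁ (suc i))) r₁-parent≡root
                                      (adj-node r₁ (i , inj₁ (refl , refl))))
  ... | j , r₁-suc-i≡suc-j , parent-j≡root =
    let D₂ , r₂ , r₂-root = rotate D₁ j parent-j≡root
    in D₂ , Relabelling-trans r₁ r₂ , trans (cong (node r₂) r₁-suc-i≡suc-j) r₂-root

  reroot : (D : TreeDecomposition G U k) (a : Node (tree D)) →
    Σ (TreeDecomposition G U k) λ D′ → bag D′ zero ≡ bag D a
  reroot D a =
    let D′ , r , r-a≡root = reroot-at D a (<-wellFounded a)
    in D′ , trans (cong (bag D′) (sym r-a≡root)) (bag-node r a)

-- Gluing tree decompositions

module Join (T₁ T₂ : Tree) (a₁ : Node T₁) where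

  m₁ m₂ : ℕ
  m₁ = size-1 T₁
  m₂ = size-1 T₂

  inl : Node T₁ → Fin (suc m₁ + suc m₂)
  inl a = a ↑ˡ suc m₂

  inr : Node T₂ → Fin (suc m₁ + suc m₂)
  inr b = suc m₁ ↑ʳ b

  joined-parent : Fin m₁ ⊎ Fin (suc m₂) → Fin (suc m₁ + suc m₂)
  joined-parent (inj₁ j)       = inl (parent T₁ j)
  joined-parent (inj₂ zero)    = inl a₁
  joined-parent (inj₂ (suc j)) = inr (parent T₂ j)

  joined-parent< : ∀ i → toℕ (joined-parent (splitAt m₁ i)) ≤ toℕ i
  joined-parent< i with splitAt m₁ i in eq
  ... | inj₁ j = begin
    toℕ (inl (parent T₁ j))   ≡⟨ toℕ-↑ˡ (parent T₁ j) (suc m₂) ⟩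
    toℕ (parent T₁ j)         ≤⟨ parent< T₁ j ⟩
    toℕ j                     ≡⟨ toℕ-↑ˡ j (suc m₂) ⟨
    toℕ (j ↑ˡ suc m₂)         ≡⟨ cong toℕ (splitAt⁻¹-↑ˡ eq) ⟩
    toℕ i                     ∎
    where open ≤-Reasoning
  ... | inj₂ zero = begin
    toℕ (inl a₁)              ≡⟨ toℕ-↑ˡ a₁ (suc m₂) ⟩
    toℕ a₁                    ≤⟨ toℕ≤pred[n] a₁ ⟩
    m₁                        ≤⟨ m≤m+n m₁ 0 ⟩
    m₁ + 0                    ≡⟨ toℕ-↑ʳ m₁ zero ⟨
    toℕ (m₁ ↑ʳ zero {m₂})     ≡⟨ cong toℕ (splitAt⁻¹-↑ʳ eq) ⟩
    toℕ i                     ∎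
    where open ≤-Reasoning
  ... | inj₂ (suc j) = begin
    toℕ (inr (parent T₂ j))   ≡⟨ toℕ-↑ʳ (suc m₁) (parent T₂ j) ⟩
    suc m₁ + toℕ (parent T₂ j) ≤⟨ +-monoʳ-≤ (suc m₁) (parent< T₂ j) ⟩
    suc m₁ + toℕ j            ≡⟨ +-suc m₁ (toℕ j) ⟨
    m₁ + toℕ (suc j)          ≡⟨ toℕ-↑ʳ m₁ (suc j) ⟨
    toℕ (m₁ ↑ʳ suc j)         ≡⟨ cong toℕ (splitAt⁻¹-↑ʳ eq) ⟩
    toℕ i                     ∎
    where open ≤-Reasoning

  joined : Tree
  joined = record
    { size-1 = m₁ + suc m₂ ; parent = joined-parent ∘ splitAt m₁ ; parent< = joined-parent< }

  data View : Node joined → Set where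
    left  : ∀ a → View (inl a)
    right : ∀ b → View (inr b)

  view : ∀ x → View x
  view x with splitAt (suc m₁) x in eq
  ... | inj₁ a = subst View (splitAt⁻¹-↑ˡ eq) (left a)
  ... | inj₂ b = subst View (splitAt⁻¹-↑ʳ eq) (right b)

  inl-adj : ∀ {a b} → TAdj T₁ a b → TAdj joined (inl a) (inl b)
  inl-adj (j , inj₁ (refl , refl)) = j ↑ˡ suc m₂ , inj₁ (refl , cong joined-parent (sym (splitAt-↑ˡ m₁ j (suc m₂))))
  inl-adj (j , inj₂ (refl , refl)) = j ↑ˡ suc m₂ , inj₂ (refl , cong joined-parent (sym (splitAt-↑ˡ m₁ j (suc m₂))))

  inr-adj : ∀ {a b} → TAdj T₂ a b → TAdj joined (inr a) (inr b)
  inr-adj (j , inj₁ (refl , refl)) = m₁ ↑ʳ suc j , inj₁ (refl , cong joined-parent (sym (splitAt-↑ʳ m₁ (suc m₂) (suc j))))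
  inr-adj (j , inj₂ (refl , refl)) = m₁ ↑ʳ suc j , inj₂ (refl , cong joined-parent (sym (splitAt-↑ʳ m₁ (suc m₂) (suc j))))

  bridge : TAdj joined (inl a₁) (inr zero)
  bridge = m₁ ↑ʳ zero , inj₂ (refl , cong joined-parent (sym (splitAt-↑ʳ m₁ (suc m₂) zero)))

module _ {G : Graph n} {k : ℕ} where

  restrict : ∀ {U W : Subset n} → TreeDecomposition G U k → W ⊆ U → TreeDecomposition G W k
  restrict {W = W} D W⊆U = record
    { tree      = tree D
    ; bag       = λ a → bag D a ∩ W
    ; bag⊆U     = λ a → proj₂ ∘ x∈p∩q⁻ _ _
    ; cover     = λ v v∈W → let a , v∈a = cover D v (W⊆U v∈W) in a , x∈p∩q⁺ (v∈a , v∈W)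
    ; edges     = λ u v u∈W v∈W uv → let a , u∈a , v∈a = edges D u v (W⊆U u∈W) (W⊆U v∈W) uv in
                    a , x∈p∩q⁺ (u∈a , u∈W) , x∈p∩q⁺ (v∈a , v∈W)
    ; connected = λ v a b v∈a v∈b → let v∈W = proj₂ (x∈p∩q⁻ _ _ v∈a) in
                    Reach-map id id (λ v∈c → x∈p∩q⁺ (v∈c , v∈W))
                      (connected D v a b (proj₁ (x∈p∩q⁻ _ _ v∈a)) (proj₁ (x∈p∩q⁻ _ _ v∈b)))
    ; width     = λ a → ≤-trans (∣p∩q∣≤∣p∣ (bag D a) W) (width D a)
    }

  module _ {U U₁ U₂ : Subset n}
           (U₁⊆U : U₁ ⊆ U) (U₂⊆U : U₂ ⊆ U) (U⊆U₁∪U₂ : U ⊆ U₁ ∪ U₂)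
           (edges-split : ∀ u v → u ∈ U → v ∈ U → Adj G u v → (u ∈ U₁ × v ∈ U₁) ⊎ (u ∈ U₂ × v ∈ U₂))
           where

    glue-at-root : (D₁ : TreeDecomposition G U₁ k) (D₂ : TreeDecomposition G U₂ k) (a₁ : Node (tree D₁)) →
      (∀ v → v ∈ U₁ → v ∈ U₂ → v ∈ bag D₁ a₁ × v ∈ bag D₂ zero) → TreeDecomposition G U k
    glue-at-root D₁ D₂ a₁ interface = record
      { tree = joined ; bag = bag′ ; bag⊆U = bag′⊆U ; cover = cover′
      ; edges = edges′ ; connected = connected′ ; width = width′ }
      where
      open Join (tree D₁) (tree D₂) a₁

      bag′ : Node joined → Subset n
      bag′ x = [ bag D₁ , bag D₂ ]′ (splitAt (suc m₁) x)

      bag′-inl : ∀ a → bag′ (inl a) ≡ bag D₁ a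
      bag′-inl a = cong [ bag D₁ , bag D₂ ]′ (splitAt-↑ˡ (suc m₁) a (suc m₂))

      bag′-inr : ∀ b → bag′ (inr b) ≡ bag D₂ b
      bag′-inr b = cong [ bag D₁ , bag D₂ ]′ (splitAt-↑ʳ (suc m₁) (suc m₂) b)

      in₁ : ∀ {v a} → v ∈ bag D₁ a → v ∈ bag′ (inl a)
      in₁ {v} {a} = subst (v ∈_) (sym (bag′-inl a))

      in₂ : ∀ {v b} → v ∈ bag D₂ b → v ∈ bag′ (inr b)
      in₂ {v} {b} = subst (v ∈_) (sym (bag′-inr b))

      out₁ : ∀ {v a} → v ∈ bag′ (inl a) → v ∈ bag D₁ a
      out₁ {v} {a} = subst (v ∈_) (bag′-inl a)

      out₂ : ∀ {v b} → v ∈ bag′ (inr b) → v ∈ bag D₂ b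
      out₂ {v} {b} = subst (v ∈_) (bag′-inr b)

      bag′⊆U : ∀ x → bag′ x ⊆ U
      bag′⊆U x with view x
      ... | left a  = λ v∈x → U₁⊆U (bag⊆U D₁ a (out₁ v∈x))
      ... | right b = λ v∈x → U₂⊆U (bag⊆U D₂ b (out₂ v∈x))

      cover′ : ∀ v → v ∈ U → ∃ λ x → v ∈ bag′ x
      cover′ v v∈U with x∈p∪q⁻ U₁ U₂ (U⊆U₁∪U₂ v∈U)
      ... | inj₁ v∈U₁ = let a , v∈a = cover D₁ v v∈U₁ in inl a , in₁ v∈a
      ... | inj₂ v∈U₂ = let b , v∈b = cover D₂ v v∈U₂ in inr b , in₂ v∈b

      edges′ : ∀ u v → u ∈ U → v ∈ U → Adj G u v → ∃ λ x → u ∈ bag′ x × v ∈ bag′ x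
      edges′ u v u∈U v∈U uv with edges-split u v u∈U v∈U uv
      ... | inj₁ (u∈U₁ , v∈U₁) = let a , u∈a , v∈a = edges D₁ u v u∈U₁ v∈U₁ uv in inl a , in₁ u∈a , in₁ v∈a
      ... | inj₂ (u∈U₂ , v∈U₂) = let b , u∈b , v∈b = edges D₂ u v u∈U₂ v∈U₂ uv in inr b , in₂ u∈b , in₂ v∈b

      lift₁ : ∀ {v a b} → Reach (TAdj (tree D₁)) (λ c → v ∈ bag D₁ c) a b →
        Reach (TAdj joined) (λ x → v ∈ bag′ x) (inl a) (inl b)
      lift₁ = Reach-map inl inl-adj in₁

      lift₂ : ∀ {v a b} → Reach (TAdj (tree D₂)) (λ c → v ∈ bag D₂ c) a b →
        Reach (TAdj joined) (λ x → v ∈ bag′ x) (inr a) (inr b)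
      lift₂ = Reach-map inr inr-adj in₂

      across : ∀ {v a b} → v ∈ bag D₁ a → v ∈ bag D₂ b → Reach (TAdj joined) (λ x → v ∈ bag′ x) (inl a) (inr b)
      across {v} {a} {b} v∈a v∈b =
        let v∈a₁ , v∈root = interface v (bag⊆U D₁ a v∈a) (bag⊆U D₂ b v∈b)
        in Reach-++ (lift₁ (connected D₁ v a a₁ v∈a v∈a₁))
                    (step (in₁ v∈a₁) bridge (lift₂ (connected D₂ v zero b v∈root v∈b)))

      connected′ : ∀ v x y → v ∈ bag′ x → v ∈ bag′ y → Reach (TAdj joined) (λ z → v ∈ bag′ z) x y
      connected′ v x y v∈x v∈y with view x | view y
      ... | left a  | left b  = lift₁ (connected D₁ v a b (out₁ v∈x) (out₁ v∈y))
      ... | right a | right b = lift₂ (connected D₂ v a b (out₂ v∈x) (out₂ v∈y))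
      ... | left a  | right b = across (out₁ v∈x) (out₂ v∈y)
      ... | right a | left b  = Reach-reverse (TAdj-sym joined) (across (out₁ v∈y) (out₂ v∈x))

      width′ : ∀ x → ∣ bag′ x ∣ ≤ suc k
      width′ x with view x
      ... | left a  rewrite bag′-inl a = width D₁ a
      ... | right b rewrite bag′-inr b = width D₂ b

    glue : (D₁ : TreeDecomposition G U₁ k) (D₂ : TreeDecomposition G U₂ k)
      (a₁ : Node (tree D₁)) (a₂ : Node (tree D₂)) →
      (∀ v → v ∈ U₁ → v ∈ U₂ → v ∈ bag D₁ a₁ × v ∈ bag D₂ a₂) → TreeDecomposition G U k
    glue D₁ D₂ a₁ a₂ interface =
      let D₂′ , root≡a₂ = reroot D₂ a₂
      in glue-at-root D₁ D₂′ a₁ λ v v∈U₁ v∈U₂ →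
           let v∈a₁ , v∈a₂ = interface v v∈U₁ v∈U₂ in v∈a₁ , subst (v ∈_) (sym root≡a₂) v∈a₂

-- Decompositions around a component

IsClique : Graph n → Subset n → Set
IsClique G K = ∀ x y → x ∈ K → y ∈ K → x ≢ y → Adj G x y

BagContaining : ∀ {G : Graph n} {U : Subset n} → TreeDecomposition G U k → Subset n → Set
BagContaining D K = ∃ λ a → K ⊆ bag D a

small-clique⊆bag : ∀ {G : Graph n} {U K : Subset n} (D : TreeDecomposition G U k) →
  K ⊆ U → AtMostTwo K → IsClique G K → BagContaining D K
small-clique⊆bag D K⊆U (none K≡∅) _ = zero , λ {v} v∈K → contradiction (v , v∈K) K≡∅
small-clique⊆bag D K⊆U (one {x} x∈K K⊆⁅x⁆) _ =
  let a , x∈a = cover D x (K⊆U x∈K) in a , λ v∈K → x∈p⇒⁅x⁆⊆p x∈a (K⊆⁅x⁆ v∈K)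
small-clique⊆bag D K⊆U (two {x} {y} x∈K y∈K x≢y K⊆⁅x⁆∪⁅y⁆) K-clique =
  let a , x∈a , y∈a = edges D x y (K⊆U x∈K) (K⊆U y∈K) (K-clique x y x∈K y∈K x≢y)
  in a , λ v∈K → [ x∈p⇒⁅x⁆⊆p x∈a , x∈p⇒⁅x⁆⊆p y∈a ]′ (x∈p∪q⁻ _ _ (K⊆⁅x⁆∪⁅y⁆ v∈K))

glue-over-Nbh : ∀ {G : Graph n} {C S W : Subset n} → S ⊆ ∁ C →
  (D₁ : TreeDecomposition G (∁ C ─ S) k) (D₂ : TreeDecomposition G W k) → C ⊆ W →
  BagContaining D₁ (Nbh G C ─ S) → BagContaining D₂ (Nbh G C ─ S) →
  TreeDecomposition G (⊤ ─ S) k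
glue-over-Nbh {G = G} {C} {S} {W} S⊆∁C D₁ D₂ C⊆W (a₁ , K⊆a₁) (a₂ , K⊆a₂) =
  glue U₁⊆U U₂⊆U U⊆U₁∪U₂ edges-split D₁ (restrict D₂ U₂⊆W) a₁ a₂ interface
  where
  K U₁ U₂ : Subset _
  K  = Nbh G C ─ S
  U₁ = ∁ C ─ S
  U₂ = C ∪ K

  C∩S≡∅ : ∀ {v} → v ∈ C → v ∉ S
  C∩S≡∅ v∈C v∈S = x∈∁p⇒x∉p (S⊆∁C v∈S) v∈C

  U₂⊆W : U₂ ⊆ W
  U₂⊆W v∈U₂ = [ C⊆W , (λ v∈K → bag⊆U D₂ a₂ (K⊆a₂ v∈K)) ]′ (x∈p∪q⁻ C K v∈U₂)

  U₁⊆U : U₁ ⊆ ⊤ ─ S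
  U₁⊆U = p⊆q⇒p─r⊆q─r S ⊆⊤

  U₂⊆U : U₂ ⊆ ⊤ ─ S
  U₂⊆U v∈U₂ = x∈p∧x∉q⇒x∈p─q ∈⊤ ([ C∩S≡∅ , x∈p─q⇒x∉q _ S ]′ (x∈p∪q⁻ C K v∈U₂))

  U⊆U₁∪U₂ : ⊤ ─ S ⊆ U₁ ∪ U₂
  U⊆U₁∪U₂ {v} v∈U with v ∈? C
  ... | yes v∈C = x∈p∪q⁺ (inj₂ (x∈p∪q⁺ (inj₁ v∈C)))
  ... | no v∉C  = x∈p∪q⁺ (inj₁ (x∈p∧x∉q⇒x∈p─q (x∉p⇒x∈∁p v∉C) (x∈p─q⇒x∉q ⊤ S v∈U)))

  crossing : ∀ {u v} → u ∈ C → v ∉ C → v ∈ ⊤ ─ S → Adj G u v → v ∈ U₂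
  crossing {u} u∈C v∉C v∈U uv =
    x∈p∪q⁺ (inj₂ (x∈p∧x∉q⇒x∈p─q (from (x∈Nbh⇔ G C) (v∉C , u , u∈C , uv)) (x∈p─q⇒x∉q ⊤ S v∈U)))

  edges-split : ∀ u v → u ∈ ⊤ ─ S → v ∈ ⊤ ─ S → Adj G u v → (u ∈ U₁ × v ∈ U₁) ⊎ (u ∈ U₂ × v ∈ U₂)
  edges-split u v u∈U v∈U uv with u ∈? C | v ∈? C
  ... | yes u∈C | yes v∈C = inj₂ (x∈p∪q⁺ (inj₁ u∈C) , x∈p∪q⁺ (inj₁ v∈C))
  ... | yes u∈C | no v∉C  = inj₂ (x∈p∪q⁺ (inj₁ u∈C) , crossing u∈C v∉C v∈U uv)
  ... | no u∉C  | yes v∈C = inj₂ (crossing v∈C u∉C u∈U (Adj-sym G uv) , x∈p∪q⁺ (inj₁ v∈C))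
  ... | no u∉C  | no v∉C  =
    inj₁ ( x∈p∧x∉q⇒x∈p─q (x∉p⇒x∈∁p u∉C) (x∈p─q⇒x∉q ⊤ S u∈U)
         , x∈p∧x∉q⇒x∈p─q (x∉p⇒x∈∁p v∉C) (x∈p─q⇒x∉q ⊤ S v∈U))

  interface : ∀ v → v ∈ U₁ → v ∈ U₂ → v ∈ bag D₁ a₁ × v ∈ bag D₂ a₂ ∩ U₂
  interface v v∈U₁ v∈U₂ with x∈p∪q⁻ C K v∈U₂
  ... | inj₁ v∈C = contradiction v∈C (x∈∁p⇒x∉p (p─q⊆p _ S v∈U₁))
  ... | inj₂ v∈K = K⊆a₁ v∈K , x∈p∩q⁺ (K⊆a₂ v∈K , v∈U₂)

TW2DLe-mono : ∀ {G : Graph n} {U U′ : Subset n} {t} → U′ ⊆ U → TW2DLe G U t → TW2DLe G U′ t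
TW2DLe-mono {U′ = U′} U′⊆U (S , _ , ∣S∣≤t , D) =
  S ∩ U′ , p∩q⊆q S U′ , ≤-trans (∣p∩q∣≤∣p∣ S U′) ∣S∣≤t , restrict D U′─S∩U′⊆U─S
  where
  U′─S∩U′⊆U─S : U′ ─ S ∩ U′ ⊆ _ ─ S
  U′─S∩U′⊆U─S v∈ =
    let v∈U′ = p─q⊆p _ _ v∈ in
    x∈p∧x∉q⇒x∈p─q (U′⊆U v∈U′) (λ v∈S → x∈p─q⇒x∉q _ _ v∈ (x∈p∩q⁺ (v∈S , v∈U′)))

component-piece : ∀ (G : Graph n) (t : ℕ) (X C S : Subset n) →
  TidyModulator G X →
  Component G (∁ X) C →
  (∀ x y → x ∈ Nbh G C → y ∈ Nbh G C → x ≢ y →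
    TwLe G (C ∪ (⁅ x ⁆ ∪ ⁅ y ⁆)) 2 ⊎ LimitSubset G (∁ C) t 1 (⁅ x ⁆ ∪ ⁅ y ⁆)) →
  Solution G (∁ C) t S → AtMostTwo (Nbh G C ─ S) →
  Σ (Subset n) λ W → C ∪ (Nbh G C ─ S) ⊆ W × TwLe G W 2
component-piece G t X C S (modulator , tidy) component@(C⊆∁X , _) pairs solution = piece
  where
  K = Nbh G C ─ S

  piece : AtMostTwo K → Σ (Subset _) λ W → C ∪ K ⊆ W × TwLe G W 2
  piece (none K≡∅) =
    ∁ X , (λ v∈ → [ C⊆∁X , (λ v∈K → contradiction (_ , v∈K) K≡∅) ]′ (x∈p∪q⁻ C K v∈)) , modulator
  piece (one {x} x∈K K⊆⁅x⁆) =
    ∁ (X - x) , (λ v∈ → [ C⊆∁[X-x] , x∈p⇒⁅x⁆⊆p x∈∁[X-x] ∘ K⊆⁅x⁆ ]′ (x∈p∪q⁻ C K v∈))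
    , tidy x (Nbh-component⊆ G component (p─q⊆p _ S x∈K))
    where
    C⊆∁[X-x] : C ⊆ ∁ (X - x)
    C⊆∁[X-x] = p⊆q⇒∁p⊇∁q (p─q⊆p X ⁅ x ⁆) ∘ C⊆∁X
    x∈∁[X-x] : x ∈ ∁ (X - x)
    x∈∁[X-x] = x∉p⇒x∈∁p λ x∈X-x → x∈p─q⇒x∉q X ⁅ x ⁆ x∈X-x (x∈⁅x⁆ x)
  piece (two {x} {y} x∈K y∈K x≢y K⊆⁅x⁆∪⁅y⁆) with pairs x y (p─q⊆p _ S x∈K) (p─q⊆p _ S y∈K) x≢y
  ... | inj₁ D = C ∪ (⁅ x ⁆ ∪ ⁅ y ⁆) , (λ v∈ → x∈p∪q⁺ ([ inj₁ , inj₂ ∘ K⊆⁅x⁆∪⁅y⁆ ]′ (x∈p∪q⁻ C K v∈))) , D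
  ... | inj₂ (_ , limit₁) = contradiction (limit₁ S solution) (<⇒≱ (x∈p∧y∈p∧x≢y⇒2≤∣p∣ x∈xy─S y∈xy─S x≢y))
    where
    x∈xy─S = x∈p∧x∉q⇒x∈p─q (x∈p∪q⁺ (inj₁ (x∈⁅x⁆ x))) (x∈p─q⇒x∉q _ S x∈K)
    y∈xy─S = x∈p∧x∉q⇒x∈p─q (x∈p∪q⁺ (inj₂ (x∈⁅x⁆ y))) (x∈p─q⇒x∉q _ S y∈K)

lemma5p11 : ∀ {n} (G : Graph n) (t : ℕ) (X C : Subset n) →
    TidyModulator G X →
    Component G (∁ X) C →
    LimitClique G (∁ C) t 2 (Nbh G C) →
    (∀ x y → x ∈ Nbh G C → y ∈ Nbh G C → x ≢ y →
      TwLe G (C ∪ (⁅ x ⁆ ∪ ⁅ y ⁆)) 2 ⊎ LimitSubset G (∁ C) t 1 (⁅ x ⁆ ∪ ⁅ y ⁆)) →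
    TW2DLe G ⊤ t ⇔ TW2DLe G (∁ C) t
lemma5p11 G t X C tidy component ((_ , limit₂) , clique) pairs = mk⇔ (TW2DLe-mono ⊆⊤) extend
  where
  extend : TW2DLe G (∁ C) t → TW2DLe G ⊤ t
  extend (S , solution@(S⊆∁C , ∣S∣≤t , D₁)) =
    let K≤2 = ∣p∣≤2⇒AtMostTwo (Nbh G C ─ S) (limit₂ S solution)
        K-clique : IsClique G (Nbh G C ─ S)
        K-clique x y x∈K y∈K = clique x y (p─q⊆p _ S x∈K) (p─q⊆p _ S y∈K)
        W , C∪K⊆W , D₂ = component-piece G t X C S tidy component pairs solution K≤2
    in S , ⊆⊤ , ∣S∣≤t ,
       glue-over-Nbh S⊆∁C D₁ D₂ (C∪K⊆W ∘ x∈p∪q⁺ ∘ inj₁)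
         (small-clique⊆bag D₁ (p⊆q⇒p─r⊆q─r S (Nbh⊆∁ G C)) K≤2 K-clique)
         (small-clique⊆bag D₂ (C∪K⊆W ∘ x∈p∪q⁺ ∘ inj₂) K≤2 K-clique)
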